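{- Let $(\lambda,\mu,\pi)$ be simplex-like with $|\lambda|=n$, let $r$ be the largest integer with $r(r+1)(r+2)/6\le n$, suppose $\lambda,\mu,\pi$ have at most $r+1$ columns each, and let $a\ge0$, $b,c\ge r+1$ be integers. Let $\tilde\lambda=(a^{bc})+\lambda$, $\tilde\mu=(b^{ac},\mu)$, $\tilde\pi=(c^{ab},\pi)$. Then the map $P\mapsto Q=\{0,\dots,a-1\}\times\{0,\dots,b-1\}\times\{0,\dots,c-1\}\cup\{(a+x,y,z):(x,y,z)\in P\}$ is a bijection between finite sets $P\subseteq\mathbb{N}^3$ with marginals $(\lambda^T,\mu^T,\pi^T)$ and finite sets $Q\subseteq\mathbb{N}^3$ with marginals $(\tilde\lambda^T,\tilde\mu^T,\tilde\pi^T)$. In particular, every such $Q$ is a pyramid.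
   Context: $\alpha^T=(\alpha^T_0,\alpha^T_1,\dots)$ is the vector of column lengths of $\alpha$. For finite $P\subseteq\mathbb{N}^3$ the marginals are $(x_P,y_P,z_P)$ with $x_P(i)$ the number of points with $x$-coordinate $i$, etc. A pyramid is a $P$ with $(x,y,z)\in P$, $x'\le x$, $y'\le y$, $z'\le z$ ($x',y',z'\ge0$) implying $(x',y',z')\in P$. For $s\ge1$, $P_s=\{(x,y,z)\in\mathbb{N}^3:x+y+z\le s-1\}$, $b_s=\sum_{v\in P_s}v$; for $n\ge1$ with $r$ maximal such that $|P_r|\le n$, $p(n)=b_r\cdot(1,1,1)+r(n-|P_r|)$. $(\lambda,\mu,\pi)$ with $|\lambda|=|\mu|=|\pi|=n\ne0$ is simplex-like if $\sum_i i\lambda^T_i+\sum_j j\mu^T_j+\sum_k k\pi^T_k=p(n)$. $(a^{bc})+\lambda$ adds $a$ to each of the first $bc$ parts of $\lambda$ (padded with zeros); $(b^{ac},\mu)$ is the partition with $ac$ parts equal to $b$ followed by the parts of $\mu$; similarly $(c^{ab},\pi)$. -}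

module Defs where

open import Data.Nat using (ℕ; zero; suc; _+_; _*_; _∸_; _≤_; _<_; _≤?_; _<?_; _≟_)
open import Data.Bool using (if_then_else_)
open import Data.Product using (_×_; _,_; proj₁; proj₂)
open import Data.List using (List; []; _∷_; length; filter; map; upTo; concatMap; replicate; _++_)
open import Data.List.Relation.Unary.All using (All)
open import Data.List.Relation.Unary.Linked using (Linked)
open import Data.List.Membership.Propositional using (_∈_)
open import Relation.Nullary.Decidable using (does)
open import Relation.Binary.PropositionalEquality using (_≡_; _≢_)
open import Function.Bundles using (_⇔_)
open import Data.Nat.ListAction using (sum)

-- Points of ℕ³ and finite subsets of ℕ³, represented as duplicate-free lists
-- (duplicate-freeness is required separately via Unique).
Point : Set
Point = ℕ × ℕ × ℕ

_≈ₛ_ : List Point → List Point → Set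
P ≈ₛ Q = ∀ v → (v ∈ P) ⇔ (v ∈ Q)

IsPartition : List ℕ → Set
IsPartition α = Linked (λ x y → y ≤ x) α × All (λ x → 1 ≤ x) α

-- column length α^T_i = number of parts of α that are > i
colLen : List ℕ → ℕ → ℕ
colLen α i = length (filter (λ p → i <? p) α)

xMarg yMarg zMarg : List Point → ℕ → ℕ
xMarg P i = length (filter (λ v → proj₁ v ≟ i) P)
yMarg P i = length (filter (λ v → proj₁ (proj₂ v) ≟ i) P)
zMarg P i = length (filter (λ v → proj₂ (proj₂ v) ≟ i) P)

HasMarginals : List Point → List ℕ → List ℕ → List ℕ → Set
HasMarginals P α β γ =
  (∀ i → xMarg P i ≡ colLen α i) × (∀ i → yMarg P i ≡ colLen β i) × (∀ i → zMarg P i ≡ colLen γ i)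

Pyramid : List Point → Set
Pyramid P = ∀ x y z x' y' z' → (x , y , z) ∈ P → x' ≤ x → y' ≤ y → z' ≤ z → (x' , y' , z') ∈ P

simplex : ℕ → List Point
simplex s =
  concatMap (λ x → concatMap (λ y → map (λ z → (x , y , z))
    (filter (λ z → suc (x + y + z) ≤? s) (upTo s))) (upTo s)) (upTo s)

-- b_s · (1,1,1) = sum of all coordinates of points of P_s
bDot : ℕ → ℕ
bDot s = sum (map (λ v → proj₁ v + proj₁ (proj₂ v) + proj₂ (proj₂ v)) (simplex s))

-- largest r ≤ k with |P_r| ≤ n (searching downward; returns 0 if none ≥ 1)
maxRUpTo : ℕ → ℕ → ℕ
maxRUpTo n zero = zero
maxRUpTo n (suc k) = if does (length (simplex (suc k)) ≤? n) then suc k else maxRUpTo n k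

-- r maximal with |P_r| ≤ n (|P_r| ≥ r, so searching r ≤ n suffices)
rOf : ℕ → ℕ
rOf n = maxRUpTo n n

pFun : ℕ → ℕ
pFun n = bDot (rOf n) + rOf n * (n ∸ length (simplex (rOf n)))

-- Σ_i i α^T_i  (α^T_i = 0 for i ≥ |α|)
weighted : List ℕ → ℕ
weighted α = sum (map (λ i → i * colLen α i) (upTo (sum α)))

SimplexLike : ℕ → List ℕ → List ℕ → List ℕ → Set
SimplexLike n lam mu pi =
  sum lam ≡ n × sum mu ≡ n × sum pi ≡ n × n ≢ 0 ×
  weighted lam + weighted mu + weighted pi ≡ pFun n

-- (a^k) + α : add a to each of the first k parts of α (padded with zeros)
addFirst : ℕ → ℕ → List ℕ → List ℕ
addFirst zero a α = α
addFirst (suc k) a [] = a ∷ addFirst k a []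
addFirst (suc k) a (x ∷ xs) = (a + x) ∷ addFirst k a xs

prepend : ℕ → ℕ → List ℕ → List ℕ
prepend k b α = replicate k b ++ α

box : ℕ → ℕ → ℕ → List Point
box a b c = concatMap (λ x → concatMap (λ y → map (λ z → (x , y , z)) (upTo c)) (upTo b)) (upTo a)

liftQ : ℕ → ℕ → ℕ → List Point → List Point
liftQ a b c P = box a b c ++ map (λ v → (a + proj₁ v , proj₂ v)) P

-- The box has marginals ((a^{bc})^T, (b^{ac})^T,
-- (c^{ab})^T), so the marginals of Q are those of the box plus those of P moved by a in
-- the x-direction; lifting is injective since the translate avoids the box.  If the parts
-- of μ, π are at most b, c, every set with the relevant marginals lies over the b × c
-- rectangle, so each slice x = i has at most bc points, and exactly bc only when it is a
-- full column.  Hence a set Q with the target marginals contains the box and is the lift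
-- of its part x ≥ a translated back.
--
-- By fibre decomposition an n-point set with marginals (λ^T, μ^T, π^T) has
-- total level Σ (x + y + z) = Σ i λ^T_i + Σ j μ^T_j + Σ k π^T_k, and an exchange argument
-- against the simplex P_r shows that every n-point set has total level at least p(n).  A
-- simplex-like P is therefore level-minimal, and minimality forces down-closure (moving a
-- point to a free lower neighbour would lower the level).  Targets are lifts of such P,
-- hence pyramids.

module Submission where

open import Defs
open import Data.Nat using (ℕ; zero; suc; _+_; _*_; _∸_; _≤_; _<_; _≤′_; ≤′-refl; ≤′-step; z≤n; s≤s; _≤?_; _<?_; _≟_)
open import Data.Nat.Properties
open import Data.Nat.ListAction using (sum)
open import Data.Nat.ListAction.Properties using (sum-++)
open import Data.Bool using (if_then_else_)
open import Data.Product using (_×_; Σ; ∃; _,_; proj₁; proj₂)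
open import Data.Product.Properties using (≡-dec)
open import Data.Sum using (inj₁; inj₂)
open import Data.Empty using (⊥; ⊥-elim)
open import Data.List using (List; []; _∷_; [_]; _++_; length; map; filter; concatMap; upTo; replicate)
open import Data.List.Properties
  using (length-++; length-map; length-upTo; length-++-sucʳ; map-++; upTo-∷ʳ
        ; filter-++; filter-accept; filter-reject; filter-none; filter-some)
open import Data.List.Relation.Unary.All as All using (All; []; _∷_; tabulate)
import Data.List.Relation.Unary.All.Properties as AllP
open import Data.List.Relation.Unary.Any as Any using (here; there; any?)
open import Data.List.Relation.Unary.AllPairs using ([]; _∷_)
open import Data.List.Relation.Unary.Unique.Propositional using (Unique)
import Data.List.Relation.Unary.Unique.Propositional.Properties as Unique
open import Data.List.Membership.Propositional using (_∈_; lose; find)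
open import Data.List.Membership.Propositional.Properties
open import Data.List.Relation.Binary.Subset.Propositional using (_⊆_)
open import Relation.Binary.PropositionalEquality hiding ([_])
open import Relation.Binary.Definitions using (DecidableEquality)
open import Relation.Nullary using (¬_; Dec; yes; no)
open import Relation.Nullary.Decidable using (does)
open import Relation.Unary using (Decidable)
open import Relation.Unary.Properties using (∁?)
open import Algebra.Properties.CommutativeSemigroup +-commutativeSemigroup using (interchange; x∙yz≈y∙xz)
open import Function.Base using (_∘_)
open import Function.Bundles using (mk⇔; Equivalence)

module _ {A : Set} where

  ∈-delete : ∀ {u v : A} ys zs → v ∈ ys ++ u ∷ zs → v ≢ u → v ∈ ys ++ zs
  ∈-delete []       zs (here v≡u) v≢u = ⊥-elim (v≢u v≡u)
  ∈-delete []       zs (there v∈)  _  = v∈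
  ∈-delete (y ∷ ys) zs (here v≡y) _   = here v≡y
  ∈-delete (y ∷ ys) zs (there v∈) v≢u = there (∈-delete ys zs v∈ v≢u)

  ∈-insert′ : ∀ {u v : A} ys zs → v ∈ ys ++ zs → v ∈ ys ++ u ∷ zs
  ∈-insert′ []       zs v∈         = there v∈
  ∈-insert′ (y ∷ ys) zs (here v≡y) = here v≡y
  ∈-insert′ (y ∷ ys) zs (there v∈) = there (∈-insert′ ys zs v∈)

  unique-delete : ∀ {u : A} ys zs → Unique (ys ++ u ∷ zs) → Unique (ys ++ zs)
  unique-delete []       zs (_ ∷ u) = u
  unique-delete (y ∷ ys) zs (y∉ ∷ u) = delete-All ys y∉ ∷ unique-delete ys zs u
    where
    delete-All : ∀ {P : A → Set} {u} ys → All P (ys ++ u ∷ zs) → All P (ys ++ zs)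
    delete-All []       (_ ∷ ps) = ps
    delete-All (_ ∷ ys) (p ∷ ps) = p ∷ delete-All ys ps

  length-mono : (xs ys : List A) → Unique xs → xs ⊆ ys → length xs ≤ length ys
  length-mono []       ys _          _   = z≤n
  length-mono (x ∷ xs) ys (x∉ ∷ uxs) sub with ∈-∃++ (sub (here refl))
  ... | ys₁ , ys₂ , refl = begin
    suc (length xs)           ≤⟨ s≤s (length-mono xs (ys₁ ++ ys₂) uxs sub′) ⟩
    suc (length (ys₁ ++ ys₂)) ≡⟨ length-++-sucʳ ys₁ x ys₂ ⟨
    length (ys₁ ++ x ∷ ys₂)   ∎
    where
    open ≤-Reasoning
    sub′ : xs ⊆ ys₁ ++ ys₂
    sub′ v∈ = ∈-delete ys₁ ys₂ (sub (there v∈)) (λ { refl → All.lookup x∉ v∈ refl })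

  length-≈ : (xs ys : List A) → Unique xs → Unique ys → xs ⊆ ys → ys ⊆ xs → length xs ≡ length ys
  length-≈ xs ys uxs uys xs⊆ys ys⊆xs = ≤-antisym (length-mono xs ys uxs xs⊆ys) (length-mono ys xs uys ys⊆xs)

  ⊆-full : DecidableEquality A → (xs ys : List A) → Unique xs → xs ⊆ ys → length ys ≤ length xs → ys ⊆ xs
  ⊆-full _≟ᴬ_ xs ys uxs xs⊆ys ys≤xs {v} v∈ys with any? (v ≟ᴬ_) xs
  ... | yes v∈xs = v∈xs
  ... | no  v∉xs with ∈-∃++ v∈ys
  ...   | ys₁ , ys₂ , refl = ⊥-elim (<-irrefl refl (begin-strict
    length xs                 ≤⟨ length-mono xs (ys₁ ++ ys₂) uxs (λ u∈ → ∈-delete ys₁ ys₂ (xs⊆ys u∈) (λ { refl → v∉xs u∈ })) ⟩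
    length (ys₁ ++ ys₂)       <⟨ n<1+n _ ⟩
    suc (length (ys₁ ++ ys₂)) ≡⟨ length-++-sucʳ ys₁ v ys₂ ⟨
    length (ys₁ ++ v ∷ ys₂)   ≤⟨ ys≤xs ⟩
    length xs                 ∎))
    where open ≤-Reasoning

  sumL : (A → ℕ) → List A → ℕ
  sumL g xs = sum (map g xs)

  sumL-++ : ∀ (g : A → ℕ) xs ys → sumL g (xs ++ ys) ≡ sumL g xs + sumL g ys
  sumL-++ g xs ys = trans (cong sum (map-++ g xs ys)) (sum-++ (map g xs) (map g ys))

  sumL-middle : ∀ (g : A → ℕ) {x} xs ys → sumL g (xs ++ x ∷ ys) ≡ g x + sumL g (xs ++ ys)
  sumL-middle g {x} xs ys = begin
    sumL g (xs ++ x ∷ ys)            ≡⟨ sumL-++ g xs (x ∷ ys) ⟩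
    sumL g xs + (g x + sumL g ys)    ≡⟨ x∙yz≈y∙xz (sumL g xs) (g x) (sumL g ys) ⟩
    g x + (sumL g xs + sumL g ys)    ≡⟨ cong (g x +_) (sumL-++ g xs ys) ⟨
    g x + sumL g (xs ++ ys)          ∎
    where open ≡-Reasoning

  sumL-+ : ∀ (f g : A → ℕ) xs → sumL (λ v → f v + g v) xs ≡ sumL f xs + sumL g xs
  sumL-+ f g []       = refl
  sumL-+ f g (x ∷ xs) = trans (cong (f x + g x +_) (sumL-+ f g xs)) (interchange (f x) (g x) (sumL f xs) (sumL g xs))

  sumL-const1 : ∀ (xs : List A) → sumL (λ _ → 1) xs ≡ length xs
  sumL-const1 []       = refl
  sumL-const1 (_ ∷ xs) = cong suc (sumL-const1 xs)

  sumL-split : ∀ (g : A → ℕ) {P : A → Set} (P? : Decidable P) xs →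
    sumL g xs ≡ sumL g (filter P? xs) + sumL g (filter (∁? P?) xs)
  sumL-split g P? []       = refl
  sumL-split g P? (x ∷ xs) with P? x
  ... | yes _ = trans (cong (g x +_) (sumL-split g P? xs)) (sym (+-assoc (g x) (sumL g (filter P? xs)) _))
  ... | no  _ = trans (cong (g x +_) (sumL-split g P? xs)) (x∙yz≈y∙xz (g x) (sumL g (filter P? xs)) _)

  sumL-bound : ∀ (g : A → ℕ) K xs → (∀ {v} → v ∈ xs → g v ≤ K) → sumL g xs ≤ K * length xs
  sumL-bound g K []       _     = z≤n
  sumL-bound g K (x ∷ xs) bound = begin
    g x + sumL g xs       ≤⟨ +-mono-≤ (bound (here refl)) (sumL-bound g K xs (bound ∘ there)) ⟩
    K + K * length xs     ≡⟨ *-suc K (length xs) ⟨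
    K * suc (length xs)   ∎
    where open ≤-Reasoning

  sumL-lower : ∀ (g : A → ℕ) s xs → (∀ {v} → v ∈ xs → s ≤ g v) → s * length xs ≤ sumL g xs
  sumL-lower g s []       _     = ≤-reflexive (*-zeroʳ s)
  sumL-lower g s (x ∷ xs) above = begin
    s * suc (length xs)   ≡⟨ *-suc s (length xs) ⟩
    s + s * length xs     ≤⟨ +-mono-≤ (above (here refl)) (sumL-lower g s xs (above ∘ there)) ⟩
    g x + sumL g xs       ∎
    where open ≤-Reasoning

  sumL-exchange : ∀ (g : A → ℕ) K (xs ys : List A) → Unique xs → xs ⊆ ys → (∀ {v} → v ∈ ys → g v ≤ K) →
    sumL g ys ≤ sumL g xs + K * (length ys ∸ length xs)
  sumL-exchange g K []       ys _          _   bound = sumL-bound g K ys bound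
  sumL-exchange g K (x ∷ xs) ys (x∉ ∷ uxs) sub bound with ∈-∃++ (sub (here refl))
  ... | ys₁ , ys₂ , refl = begin
    sumL g (ys₁ ++ x ∷ ys₂)                              ≡⟨ sumL-middle g ys₁ ys₂ ⟩
    g x + sumL g (ys₁ ++ ys₂)                            ≤⟨ +-monoʳ-≤ (g x) ih ⟩
    g x + (sumL g xs + K * (length (ys₁ ++ ys₂) ∸ length xs)) ≡⟨ +-assoc (g x) _ _ ⟨
    g x + sumL g xs + K * (length (ys₁ ++ ys₂) ∸ length xs) ≡⟨ cong (λ l → g x + sumL g xs + K * (l ∸ suc (length xs)))
                                                               (length-++-sucʳ ys₁ x ys₂) ⟨
    g x + sumL g xs + K * (length (ys₁ ++ x ∷ ys₂) ∸ suc (length xs)) ∎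
    where
    open ≤-Reasoning
    ih : sumL g (ys₁ ++ ys₂) ≤ sumL g xs + K * (length (ys₁ ++ ys₂) ∸ length xs)
    ih = sumL-exchange g K xs (ys₁ ++ ys₂) uxs
           (λ v∈ → ∈-delete ys₁ ys₂ (sub (there v∈)) (λ { refl → All.lookup x∉ v∈ refl }))
           (bound ∘ ∈-insert′ ys₁ ys₂)

  count : (A → ℕ) → List A → ℕ → ℕ
  count h xs i = length (filter (λ v → h v ≟ i) xs)

  module _ (h : A → ℕ) where

    count-++ : ∀ xs ys i → count h (xs ++ ys) i ≡ count h xs i + count h ys i
    count-++ xs ys i = trans (cong length (filter-++ (λ v → h v ≟ i) xs ys)) (length-++ (filter (λ v → h v ≟ i) xs))

    count-hit : ∀ {x} xs {i} → h x ≡ i → count h (x ∷ xs) i ≡ suc (count h xs i)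
    count-hit xs {i} hx≡i = cong length (filter-accept (λ v → h v ≟ i) {xs = xs} hx≡i)

    count-miss : ∀ {x} xs {i} → h x ≢ i → count h (x ∷ xs) i ≡ count h xs i
    count-miss xs {i} hx≢i = cong length (filter-reject (λ v → h v ≟ i) {xs = xs} hx≢i)

    count-none : ∀ xs {i} → (∀ {v} → v ∈ xs → h v ≢ i) → count h xs i ≡ 0
    count-none xs {i} miss = cong length (filter-none (λ v → h v ≟ i) (tabulate miss))

    count-pos : ∀ {x xs} → x ∈ xs → 0 < count h xs (h x)
    count-pos {x} x∈ = filter-some (λ v → h v ≟ h x) (Any.map (λ { refl → refl }) x∈)

    fibre? : ∀ i → Decidable (λ v → h v ≡ i)
    fibre? i v = h v ≟ i

    count-fibre : ∀ xs F i → Unique xs → Unique F →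
      (∀ {v} → v ∈ xs → h v ≡ i → v ∈ F) → (∀ {v} → v ∈ F → v ∈ xs × h v ≡ i) → count h xs i ≡ length F
    count-fibre xs F i uxs uF into onto =
      length-≈ _ F (Unique.filter⁺ (fibre? i) uxs) uF
        (λ v∈ → let v∈xs , hv≡i = ∈-filter⁻ (fibre? i) {xs = xs} v∈ in into v∈xs hv≡i)
        (λ v∈F → let v∈xs , hv≡i = onto v∈F in ∈-filter⁺ (fibre? i) v∈xs hv≡i)

    count-≈ : ∀ xs ys i → Unique xs → Unique ys → xs ⊆ ys → ys ⊆ xs → count h xs i ≡ count h ys i
    count-≈ xs ys i uxs uys xs⊆ys ys⊆xs =
      count-fibre xs (filter (fibre? i) ys) i uxs (Unique.filter⁺ (fibre? i) uys)
        (λ v∈ hv≡i → ∈-filter⁺ (fibre? i) (xs⊆ys v∈) hv≡i)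
        (λ v∈ → let v∈ys , hv≡i = ∈-filter⁻ (fibre? i) {xs = ys} v∈ in ys⊆xs v∈ys , hv≡i)

  count-map : ∀ (h : A → ℕ) (f : A → A) xs i → count h (map f xs) i ≡ count (h ∘ f) xs i
  count-map h f []       i = refl
  count-map h f (x ∷ xs) i with h (f x) ≟ i
  ... | yes hit  = trans (count-hit h (map f xs) hit) (trans (cong suc (count-map h f xs i)) (sym (count-hit (h ∘ f) xs hit)))
  ... | no  miss = trans (count-miss h (map f xs) miss) (trans (count-map h f xs i) (sym (count-miss (h ∘ f) xs miss)))

  count-inj : ∀ (f : ℕ → ℕ) → (∀ {m n} → f m ≡ f n → m ≡ n) → ∀ (h : A → ℕ) xs i →
    count (f ∘ h) xs (f i) ≡ count h xs i
  count-inj f f-inj h []       i = refl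
  count-inj f f-inj h (x ∷ xs) i with h x ≟ i | f (h x) ≟ f i
  ... | yes hit  | yes fhit  =
    trans (count-hit (f ∘ h) xs fhit) (trans (cong suc (count-inj f f-inj h xs i)) (sym (count-hit h xs hit)))
  ... | no  miss | no  fmiss =
    trans (count-miss (f ∘ h) xs fmiss) (trans (count-inj f f-inj h xs i) (sym (count-miss h xs miss)))
  ... | yes hx≡i | no fhx≢fi = ⊥-elim (fhx≢fi (cong f hx≡i))
  ... | no  hx≢i | yes fhx≡fi = ⊥-elim (hx≢i (f-inj fhx≡fi))

sumUpTo : ℕ → (ℕ → ℕ) → ℕ
sumUpTo N f = sum (map f (upTo N))

sumUpTo-suc : ∀ N f → sumUpTo (suc N) f ≡ sumUpTo N f + f N
sumUpTo-suc N f = begin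
  sum (map f (upTo (suc N)))          ≡⟨ cong (sum ∘ map f) (upTo-∷ʳ N) ⟨
  sum (map f (upTo N ++ [ N ]))       ≡⟨ cong sum (map-++ f (upTo N) [ N ]) ⟩
  sum (map f (upTo N) ++ [ f N ])     ≡⟨ sum-++ (map f (upTo N)) [ f N ] ⟩
  sumUpTo N f + (f N + 0)             ≡⟨ cong (sumUpTo N f +_) (+-identityʳ (f N)) ⟩
  sumUpTo N f + f N                   ∎
  where open ≡-Reasoning

sumUpTo-cong : ∀ N f g → (∀ i → i < N → f i ≡ g i) → sumUpTo N f ≡ sumUpTo N g
sumUpTo-cong zero    f g eq = refl
sumUpTo-cong (suc N) f g eq = begin
  sumUpTo (suc N) f   ≡⟨ sumUpTo-suc N f ⟩
  sumUpTo N f + f N   ≡⟨ cong₂ _+_ (sumUpTo-cong N f g (λ i i<N → eq i (m<n⇒m<1+n i<N))) (eq N ≤-refl) ⟩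
  sumUpTo N g + g N   ≡⟨ sumUpTo-suc N g ⟨
  sumUpTo (suc N) g   ∎
  where open ≡-Reasoning

sumUpTo-zero : ∀ N f → (∀ i → f i ≡ 0) → sumUpTo N f ≡ 0
sumUpTo-zero zero    f f≡0 = refl
sumUpTo-zero (suc N) f f≡0 = trans (sumUpTo-suc N f) (cong₂ _+_ (sumUpTo-zero N f f≡0) (f≡0 N))

sumUpTo-incr : ∀ N f → sumUpTo N (suc ∘ f) ≡ N + sumUpTo N f
sumUpTo-incr zero    f = refl
sumUpTo-incr (suc N) f = begin
  sumUpTo (suc N) (suc ∘ f)     ≡⟨ sumUpTo-suc N (suc ∘ f) ⟩
  sumUpTo N (suc ∘ f) + suc (f N) ≡⟨ cong (_+ suc (f N)) (sumUpTo-incr N f) ⟩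
  N + sumUpTo N f + suc (f N)   ≡⟨ +-suc (N + sumUpTo N f) (f N) ⟩
  suc (N + sumUpTo N f + f N)   ≡⟨ cong suc (+-assoc N (sumUpTo N f) (f N)) ⟩
  suc N + (sumUpTo N f + f N)   ≡⟨ cong (suc N +_) (sumUpTo-suc N f) ⟨
  suc N + sumUpTo (suc N) f     ∎
  where open ≡-Reasoning

sumUpTo-bump : ∀ N k x F G → k < N → (∀ i → i ≢ k → F i ≡ G i) → F k ≡ x + G k →
  sumUpTo N F ≡ x + sumUpTo N G
sumUpTo-bump (suc M) k x F G k<N same bumped with m≤n⇒m<n∨m≡n (≤-pred k<N)
... | inj₁ k<M = begin
  sumUpTo (suc M) F         ≡⟨ sumUpTo-suc M F ⟩
  sumUpTo M F + F M         ≡⟨ cong₂ _+_ (sumUpTo-bump M k x F G k<M same bumped) (same M (λ { refl → <-irrefl refl k<M })) ⟩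
  x + sumUpTo M G + G M     ≡⟨ +-assoc x (sumUpTo M G) (G M) ⟩
  x + (sumUpTo M G + G M)   ≡⟨ cong (x +_) (sumUpTo-suc M G) ⟨
  x + sumUpTo (suc M) G     ∎
  where open ≡-Reasoning
... | inj₂ refl = begin
  sumUpTo (suc k) F         ≡⟨ sumUpTo-suc k F ⟩
  sumUpTo k F + F k         ≡⟨ cong₂ _+_ (sumUpTo-cong k F G (λ i i<k → same i (λ { refl → <-irrefl refl i<k }))) bumped ⟩
  sumUpTo k G + (x + G k)   ≡⟨ x∙yz≈y∙xz (sumUpTo k G) x (G k) ⟩
  x + (sumUpTo k G + G k)   ≡⟨ cong (x +_) (sumUpTo-suc k G) ⟨
  x + sumUpTo (suc k) G     ∎
  where open ≡-Reasoning

fibre-sum : ∀ {A : Set} (g : ℕ → ℕ) (h : A → ℕ) N xs → All (λ v → h v < N) xs →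
  sumUpTo N (λ i → g i * count h xs i) ≡ sumL (g ∘ h) xs
fibre-sum g h N []       []             = sumUpTo-zero N _ (λ i → *-zeroʳ (g i))
fibre-sum g h N (x ∷ xs) (hx<N ∷ bound) = begin
  sumUpTo N (λ i → g i * count h (x ∷ xs) i) ≡⟨ sumUpTo-bump N (h x) (g (h x)) _ _ hx<N
                                                  (λ i i≢hx → cong (g i *_) (count-miss h xs (i≢hx ∘ sym)))
                                                  (trans (cong (g (h x) *_) (count-hit h xs refl)) (*-suc (g (h x)) _)) ⟩
  g (h x) + sumUpTo N (λ i → g i * count h xs i) ≡⟨ cong (g (h x) +_) (fibre-sum g h N xs bound) ⟩
  g (h x) + sumL (g ∘ h) xs                    ∎
  where open ≡-Reasoning

colLen-hit : ∀ {i p} α → i < p → colLen (p ∷ α) i ≡ suc (colLen α i)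
colLen-hit {i} α i<p = cong length (filter-accept (i <?_) {xs = α} i<p)

colLen-miss : ∀ {i p} α → ¬ i < p → colLen (p ∷ α) i ≡ colLen α i
colLen-miss {i} α i≮p = cong length (filter-reject (i <?_) {xs = α} i≮p)

colLen-++ : ∀ α β i → colLen (α ++ β) i ≡ colLen α i + colLen β i
colLen-++ α β i = trans (cong length (filter-++ (i <?_) α β)) (length-++ (filter (i <?_) α))

colLen-rect-below : ∀ k b {i} → i < b → colLen (replicate k b) i ≡ k
colLen-rect-below zero    b i<b = refl
colLen-rect-below (suc k) b i<b = trans (colLen-hit (replicate k b) i<b) (cong suc (colLen-rect-below k b i<b))

colLen-rect-above : ∀ k b {i} → b ≤ i → colLen (replicate k b) i ≡ 0
colLen-rect-above zero    b b≤i = refl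
colLen-rect-above (suc k) b b≤i = trans (colLen-miss (replicate k b) (≤⇒≯ b≤i)) (colLen-rect-above k b b≤i)

colLen-all : ∀ {i} α → All (i <_) α → colLen α i ≡ length α
colLen-all []      []           = refl
colLen-all (p ∷ α) (i<p ∷ i<α) = trans (colLen-hit α i<p) (cong suc (colLen-all α i<α))

colLen-pos⇒< : ∀ {B i} α → All (_≤ B) α → 0 < colLen α i → i < B
colLen-pos⇒< {B} {i} (p ∷ α) (p≤B ∷ α≤B) pos with i <? p
... | yes i<p = <-≤-trans i<p p≤B
... | no  i≮p = colLen-pos⇒< α α≤B (subst (0 <_) (colLen-miss α i≮p) pos)

parts≤sum : ∀ α → All (_≤ sum α) α
parts≤sum []      = []
parts≤sum (p ∷ α) = m≤m+n p (sum α) ∷ All.map (λ q≤ → ≤-trans q≤ (m≤n+m (sum α) p)) (parts≤sum α)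

sumUpTo-colLen : ∀ N α → All (_≤ N) α → sumUpTo N (colLen α) ≡ sum α
sumUpTo-colLen N []      []           = sumUpTo-zero N (colLen []) (λ _ → refl)
sumUpTo-colLen N (p ∷ α) (p≤N ∷ α≤N) = trans (add-part N p≤N) (cong (p +_) (sumUpTo-colLen N α α≤N))
  where
  add-part : ∀ N {p} → p ≤ N → sumUpTo N (colLen (p ∷ α)) ≡ p + sumUpTo N (colLen α)
  add-part zero    z≤n = refl
  add-part (suc M) {p} p≤N with m≤n⇒m<n∨m≡n p≤N
  ... | inj₁ p<N = begin
    sumUpTo (suc M) (colLen (p ∷ α))         ≡⟨ sumUpTo-suc M (colLen (p ∷ α)) ⟩
    sumUpTo M (colLen (p ∷ α)) + colLen (p ∷ α) M ≡⟨ cong₂ _+_ (add-part M (≤-pred p<N)) (colLen-miss α (≤⇒≯ (≤-pred p<N))) ⟩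
    p + sumUpTo M (colLen α) + colLen α M   ≡⟨ +-assoc p _ _ ⟩
    p + (sumUpTo M (colLen α) + colLen α M) ≡⟨ cong (p +_) (sumUpTo-suc M (colLen α)) ⟨
    p + sumUpTo (suc M) (colLen α)           ∎
    where open ≡-Reasoning
  ... | inj₂ refl = begin
    sumUpTo (suc M) (colLen (suc M ∷ α))    ≡⟨ sumUpTo-cong (suc M) _ _ (λ i i<p → colLen-hit α i<p) ⟩
    sumUpTo (suc M) (suc ∘ colLen α)        ≡⟨ sumUpTo-incr (suc M) (colLen α) ⟩
    suc M + sumUpTo (suc M) (colLen α)      ∎
    where open ≡-Reasoning

colLen-addFirst-below : ∀ k a lam {i} → length lam ≤ k → i < a → colLen (addFirst k a lam) i ≡ k
colLen-addFirst-below zero    a []        z≤n      i<a = refl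
colLen-addFirst-below (suc k) a []        _        i<a =
  trans (colLen-hit (addFirst k a []) i<a) (cong suc (colLen-addFirst-below k a [] z≤n i<a))
colLen-addFirst-below (suc k) a (p ∷ lam) (s≤s ≤k) i<a =
  trans (colLen-hit (addFirst k a lam) (<-≤-trans i<a (m≤m+n a p))) (cong suc (colLen-addFirst-below k a lam ≤k i<a))

colLen-addFirst-above : ∀ k a lam i → (0 < a → length lam ≤ k) → colLen (addFirst k a lam) (a + i) ≡ colLen lam i
colLen-addFirst-above zero    zero    lam       i _     = refl
colLen-addFirst-above zero    (suc a) []        i _     = refl
colLen-addFirst-above zero    (suc a) (p ∷ lam) i short with short (s≤s z≤n)
... | ()
colLen-addFirst-above (suc k) a       []        i _     =
  trans (colLen-miss (addFirst k a []) (≤⇒≯ (m≤m+n a i))) (colLen-addFirst-above k a [] i (λ _ → z≤n))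
colLen-addFirst-above (suc k) a       (p ∷ lam) i short with i <? p
... | yes i<p = begin
  colLen (addFirst (suc k) a (p ∷ lam)) (a + i) ≡⟨ colLen-hit (addFirst k a lam) (+-monoʳ-< a i<p) ⟩
  suc (colLen (addFirst k a lam) (a + i))       ≡⟨ cong suc (colLen-addFirst-above k a lam i (≤-pred ∘ short)) ⟩
  suc (colLen lam i)                             ≡⟨ colLen-hit lam i<p ⟨
  colLen (p ∷ lam) i                             ∎
  where open ≡-Reasoning
... | no  i≮p = begin
  colLen (addFirst (suc k) a (p ∷ lam)) (a + i) ≡⟨ colLen-miss (addFirst k a lam) (i≮p ∘ +-cancelˡ-< a i p) ⟩
  colLen (addFirst k a lam) (a + i)             ≡⟨ colLen-addFirst-above k a lam i (≤-pred ∘ short) ⟩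
  colLen lam i                                   ≡⟨ colLen-miss lam i≮p ⟨
  colLen (p ∷ lam) i                             ∎
  where open ≡-Reasoning

length≤colLen-addFirst : ∀ k a lam {i} → i < a → All (i <_) lam → length lam ≤ colLen (addFirst k a lam) i
length≤colLen-addFirst zero    a lam       i<a i<λ       = ≤-reflexive (sym (colLen-all lam i<λ))
length≤colLen-addFirst (suc k) a []        i<a _         = z≤n
length≤colLen-addFirst (suc k) a (p ∷ lam) i<a (_ ∷ i<λ) =
  subst (suc (length lam) ≤_) (sym (colLen-hit (addFirst k a lam) (<-≤-trans i<a (m≤m+n a p))))
    (s≤s (length≤colLen-addFirst k a lam i<a i<λ))

module _ {A : Set} (h : A → ℕ) (xs : List A) (α : List ℕ) (marg : ∀ i → count h xs i ≡ colLen α i) where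

  marg-bound : ∀ {B} → All (_≤ B) α → ∀ {v} → v ∈ xs → h v < B
  marg-bound α≤B {v} v∈ = colLen-pos⇒< α α≤B (subst (0 <_) (marg (h v)) (count-pos h v∈))

  length-marg : length xs ≡ sum α
  length-marg = begin
    length xs                                        ≡⟨ sumL-const1 xs ⟨
    sumL (λ _ → 1) xs                                ≡⟨ fibre-sum (λ _ → 1) h (sum α) xs (tabulate (marg-bound (parts≤sum α))) ⟨
    sumUpTo (sum α) (λ i → 1 * count h xs i)         ≡⟨ sumUpTo-cong (sum α) _ _ (λ i _ → trans (*-identityˡ _) (marg i)) ⟩
    sumUpTo (sum α) (colLen α)                       ≡⟨ sumUpTo-colLen (sum α) α (parts≤sum α) ⟩
    sum α                                            ∎
    where open ≡-Reasoning

  weighted-marg : weighted α ≡ sumL h xs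
  weighted-marg = begin
    sumUpTo (sum α) (λ i → i * colLen α i)          ≡⟨ sumUpTo-cong (sum α) _ _ (λ i _ → cong (i *_) (sym (marg i))) ⟩
    sumUpTo (sum α) (λ i → i * count h xs i)        ≡⟨ fibre-sum (λ i → i) h (sum α) xs (tabulate (marg-bound (parts≤sum α))) ⟩
    sumL h xs                                        ∎
    where open ≡-Reasoning

xOf yOf zOf level : Point → ℕ
xOf   = proj₁
yOf v = proj₁ (proj₂ v)
zOf v = proj₂ (proj₂ v)
level v = xOf v + yOf v + zOf v

-- The total level of a set with marginals (λ^T, μ^T, π^T) is the weighted sum of the
-- three transposes, the quantity that simplex-likeness pins to p(n).
level-marg : ∀ P lam mu pi → HasMarginals P lam mu pi → sumL level P ≡ weighted lam + weighted mu + weighted pi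
level-marg P lam mu pi (mx , my , mz) = begin
  sumL level P                                  ≡⟨ sumL-+ (λ v → xOf v + yOf v) zOf P ⟩
  sumL (λ v → xOf v + yOf v) P + sumL zOf P     ≡⟨ cong (_+ sumL zOf P) (sumL-+ xOf yOf P) ⟩
  sumL xOf P + sumL yOf P + sumL zOf P          ≡⟨ cong₂ _+_ (cong₂ _+_ (weighted-marg xOf P lam mx) (weighted-marg yOf P mu my))
                                                              (weighted-marg zOf P pi mz) ⟨
  weighted lam + weighted mu + weighted pi      ∎
  where open ≡-Reasoning

module _ {A B : Set} (f : A → List B) where

  ∈-concatMap-intro : ∀ {x xs y} → x ∈ xs → y ∈ f x → y ∈ concatMap f xs
  ∈-concatMap-intro x∈ y∈ = ∈-concatMap⁺ f (lose x∈ y∈)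

  ∈-concatMap-elim : ∀ xs {y} → y ∈ concatMap f xs → ∃ λ x → x ∈ xs × y ∈ f x
  ∈-concatMap-elim xs y∈ = find (∈-concatMap⁻ f {xs = xs} y∈)

  unique-concatMap : (tag : B → A) → (∀ x {y} → y ∈ f x → tag y ≡ x) →
    (∀ x → Unique (f x)) → ∀ {xs} → Unique xs → Unique (concatMap f xs)
  unique-concatMap tag tagged uf {[]}     []          = []
  unique-concatMap tag tagged uf {x ∷ xs} (x∉ ∷ uxs) =
    Unique.++⁺ (uf x) (unique-concatMap tag tagged uf uxs) disjoint
    where
    disjoint : ∀ {y} → ¬ (y ∈ f x × y ∈ concatMap f xs)
    disjoint (y∈fx , y∈rest) =
      let x′ , x′∈xs , y∈fx′ = ∈-concatMap-elim xs y∈rest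
      in All.lookup x∉ x′∈xs (trans (sym (tagged x y∈fx)) (tagged x′ y∈fx′))

triples : List ℕ → (ℕ → List ℕ) → (ℕ → ℕ → List ℕ) → List Point
triples xs ys zs = concatMap (λ x → concatMap (λ y → map (λ z → (x , y , z)) (zs x y)) (ys x)) xs

cuboid : List ℕ → List ℕ → List ℕ → List Point
cuboid xs ys zs = triples xs (λ _ → ys) (λ _ _ → zs)

module _ {xs : List ℕ} {ys : ℕ → List ℕ} {zs : ℕ → ℕ → List ℕ} where

  ∈-triples⁺ : ∀ {x y z} → x ∈ xs → y ∈ ys x → z ∈ zs x y → (x , y , z) ∈ triples xs ys zs
  ∈-triples⁺ {x} {y} x∈ y∈ z∈ =
    ∈-concatMap-intro _ x∈ (∈-concatMap-intro _ y∈ (∈-map⁺ (λ z → (x , y , z)) z∈))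

  ∈-triples⁻ : ∀ {x y z} → (x , y , z) ∈ triples xs ys zs → x ∈ xs × y ∈ ys x × z ∈ zs x y
  ∈-triples⁻ v∈ with ∈-concatMap-elim _ xs v∈
  ... | x , x∈ , v∈row with ∈-concatMap-elim _ (ys x) v∈row
  ... | y , y∈ , v∈col with ∈-map⁻ (λ z → (x , y , z)) v∈col
  ... | z , z∈ , refl = x∈ , y∈ , z∈

  unique-triples : Unique xs → (∀ x → Unique (ys x)) → (∀ x y → Unique (zs x y)) → Unique (triples xs ys zs)
  unique-triples uxs uys uzs =
    unique-concatMap _ xOf row-tag
      (λ x → unique-concatMap _ yOf (col-tag x) (λ y → Unique.map⁺ (cong zOf) (uzs x y)) (uys x))
      uxs
    where
    col-tag : ∀ x y {v} → v ∈ map (λ z → (x , y , z)) (zs x y) → yOf v ≡ y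
    col-tag x y v∈ with ∈-map⁻ (λ z → (x , y , z)) v∈
    ... | _ , _ , refl = refl
    row-tag : ∀ x {v} → v ∈ concatMap (λ y → map (λ z → (x , y , z)) (zs x y)) (ys x) → xOf v ≡ x
    row-tag x v∈ with ∈-concatMap-elim _ (ys x) v∈
    ... | y , _ , v∈col with ∈-map⁻ (λ z → (x , y , z)) v∈col
    ... | _ , _ , refl = refl

length-cuboid : ∀ xs ys zs → length (cuboid xs ys zs) ≡ length xs * (length ys * length zs)
length-cuboid xs ys zs = length-blocks xs (λ _ → length-blocks ys (λ _ → length-map _ zs))
  where
  length-blocks : ∀ {A B : Set} {f : A → List B} {k} as → (∀ x → length (f x) ≡ k) → length (concatMap f as) ≡ length as * k
  length-blocks []       _   = refl
  length-blocks {f = f} (x ∷ as) len = trans (length-++ (f x)) (cong₂ _+_ (len x) (length-blocks as len))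

_≟ₚ_ : DecidableEquality Point
_≟ₚ_ = ≡-dec _≟_ (≡-dec _≟_ _≟_)

module _ (a b c : ℕ) where

  box-unique : Unique (box a b c)
  box-unique = unique-triples (Unique.upTo⁺ a) (λ _ → Unique.upTo⁺ b) (λ _ _ → Unique.upTo⁺ c)

  ∈-box⁺ : ∀ {x y z} → x < a → y < b → z < c → (x , y , z) ∈ box a b c
  ∈-box⁺ x<a y<b z<c = ∈-triples⁺ (∈-upTo⁺ x<a) (∈-upTo⁺ y<b) (∈-upTo⁺ z<c)

  ∈-box⁻ : ∀ {v} → v ∈ box a b c → xOf v < a × yOf v < b × zOf v < c
  ∈-box⁻ {x , y , z} v∈ = let x∈ , y∈ , z∈ = ∈-triples⁻ v∈ in ∈-upTo⁻ x∈ , ∈-upTo⁻ y∈ , ∈-upTo⁻ z∈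

  -- The fibres of the box are full cuboid slices, so its marginals are the transposes
  -- of the rectangles (a^{bc}), (b^{ac}), (c^{ab}).
  box-xMarg : ∀ i → xMarg (box a b c) i ≡ colLen (replicate (b * c) a) i
  box-xMarg i with i <? a
  ... | no  i≮a = trans (count-none xOf (box a b c) (λ v∈ → λ { refl → i≮a (proj₁ (∈-box⁻ v∈)) }))
                        (sym (colLen-rect-above (b * c) a (≮⇒≥ i≮a)))
  ... | yes i<a = begin
    xMarg (box a b c) i                          ≡⟨ count-fibre xOf (box a b c) F i box-unique uF into onto ⟩
    length F                                     ≡⟨ length-cuboid [ i ] (upTo b) (upTo c) ⟩
    1 * (length (upTo b) * length (upTo c))      ≡⟨ trans (*-identityˡ _) (cong₂ _*_ (length-upTo b) (length-upTo c)) ⟩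
    b * c                                        ≡⟨ colLen-rect-below (b * c) a i<a ⟨
    colLen (replicate (b * c) a) i               ∎
    where
    open ≡-Reasoning
    F : List Point
    F = cuboid [ i ] (upTo b) (upTo c)
    uF : Unique F
    uF = unique-triples ([] ∷ []) (λ _ → Unique.upTo⁺ b) (λ _ _ → Unique.upTo⁺ c)
    into : ∀ {v} → v ∈ box a b c → xOf v ≡ i → v ∈ F
    into {x , y , z} v∈ refl = let _ , y<b , z<c = ∈-box⁻ v∈ in ∈-triples⁺ {xs = [ i ]} (here refl) (∈-upTo⁺ y<b) (∈-upTo⁺ z<c)
    onto : ∀ {v} → v ∈ F → v ∈ box a b c × xOf v ≡ i
    onto {x , y , z} v∈ with ∈-triples⁻ {xs = [ i ]} {ys = λ _ → upTo b} {zs = λ _ _ → upTo c} v∈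
    ... | here refl , y∈ , z∈ = ∈-box⁺ i<a (∈-upTo⁻ y∈) (∈-upTo⁻ z∈) , refl

  box-yMarg : ∀ j → yMarg (box a b c) j ≡ colLen (replicate (a * c) b) j
  box-yMarg j with j <? b
  ... | no  j≮b = trans (count-none yOf (box a b c) (λ v∈ → λ { refl → j≮b (proj₁ (proj₂ (∈-box⁻ v∈))) }))
                        (sym (colLen-rect-above (a * c) b (≮⇒≥ j≮b)))
  ... | yes j<b = begin
    yMarg (box a b c) j                          ≡⟨ count-fibre yOf (box a b c) F j box-unique uF into onto ⟩
    length F                                     ≡⟨ length-cuboid (upTo a) [ j ] (upTo c) ⟩
    length (upTo a) * (1 * length (upTo c))      ≡⟨ cong₂ _*_ (length-upTo a) (trans (*-identityˡ _) (length-upTo c)) ⟩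
    a * c                                        ≡⟨ colLen-rect-below (a * c) b j<b ⟨
    colLen (replicate (a * c) b) j               ∎
    where
    open ≡-Reasoning
    F : List Point
    F = cuboid (upTo a) [ j ] (upTo c)
    uF : Unique F
    uF = unique-triples (Unique.upTo⁺ a) (λ _ → [] ∷ []) (λ _ _ → Unique.upTo⁺ c)
    into : ∀ {v} → v ∈ box a b c → yOf v ≡ j → v ∈ F
    into {x , y , z} v∈ refl = let x<a , _ , z<c = ∈-box⁻ v∈ in ∈-triples⁺ {ys = λ _ → [ j ]} (∈-upTo⁺ x<a) (here refl) (∈-upTo⁺ z<c)
    onto : ∀ {v} → v ∈ F → v ∈ box a b c × yOf v ≡ j
    onto {x , y , z} v∈ with ∈-triples⁻ {xs = upTo a} {ys = λ _ → [ j ]} {zs = λ _ _ → upTo c} v∈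
    ... | x∈ , here refl , z∈ = ∈-box⁺ (∈-upTo⁻ x∈) j<b (∈-upTo⁻ z∈) , refl

  box-zMarg : ∀ k → zMarg (box a b c) k ≡ colLen (replicate (a * b) c) k
  box-zMarg k with k <? c
  ... | no  k≮c = trans (count-none zOf (box a b c) (λ v∈ → λ { refl → k≮c (proj₂ (proj₂ (∈-box⁻ v∈))) }))
                        (sym (colLen-rect-above (a * b) c (≮⇒≥ k≮c)))
  ... | yes k<c = begin
    zMarg (box a b c) k                          ≡⟨ count-fibre zOf (box a b c) F k box-unique uF into onto ⟩
    length F                                     ≡⟨ length-cuboid (upTo a) (upTo b) [ k ] ⟩
    length (upTo a) * (length (upTo b) * 1)      ≡⟨ cong₂ _*_ (length-upTo a) (trans (*-identityʳ _) (length-upTo b)) ⟩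
    a * b                                        ≡⟨ colLen-rect-below (a * b) c k<c ⟨
    colLen (replicate (a * b) c) k               ∎
    where
    open ≡-Reasoning
    F : List Point
    F = cuboid (upTo a) (upTo b) [ k ]
    uF : Unique F
    uF = unique-triples (Unique.upTo⁺ a) (λ _ → Unique.upTo⁺ b) (λ _ _ → [] ∷ [])
    into : ∀ {v} → v ∈ box a b c → zOf v ≡ k → v ∈ F
    into {x , y , z} v∈ refl = let x<a , y<b , _ = ∈-box⁻ v∈ in ∈-triples⁺ {zs = λ _ _ → [ k ]} (∈-upTo⁺ x<a) (∈-upTo⁺ y<b) (here refl)
    onto : ∀ {v} → v ∈ F → v ∈ box a b c × zOf v ≡ k
    onto {x , y , z} v∈ with ∈-triples⁻ {xs = upTo a} {ys = λ _ → upTo b} {zs = λ _ _ → [ k ]} v∈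
    ... | x∈ , y∈ , here refl = ∈-box⁺ (∈-upTo⁻ x∈) (∈-upTo⁻ y∈) k<c , refl
OverRect : ℕ → ℕ → List Point → Set
OverRect b c X = ∀ {v} → v ∈ X → yOf v < b × zOf v < c

marg-overRect : ∀ {b c} X lam mu pi → All (_≤ b) mu → All (_≤ c) pi → HasMarginals X lam mu pi → OverRect b c X
marg-overRect X lam mu pi mu≤b pi≤c (_ , my , mz) v∈ = marg-bound yOf X mu my mu≤b v∈ , marg-bound zOf X pi mz pi≤c v∈

module _ {b c : ℕ} (X : List Point) (uX : Unique X) (over : OverRect b c X) (i : ℕ) where

  private
    column : List Point
    column = cuboid [ i ] (upTo b) (upTo c)

    length-column : length column ≡ b * c
    length-column = trans (length-cuboid [ i ] (upTo b) (upTo c)) (trans (*-identityˡ _) (cong₂ _*_ (length-upTo b) (length-upTo c)))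

    slice? : Decidable (λ v → xOf v ≡ i)
    slice? v = xOf v ≟ i

    unique-slice : Unique (filter slice? X)
    unique-slice = Unique.filter⁺ slice? uX

    slice⊆column : filter slice? X ⊆ column
    slice⊆column {x , y , z} v∈ with ∈-filter⁻ slice? {xs = X} v∈
    ... | v∈X , refl = let y<b , z<c = over v∈X in ∈-triples⁺ {xs = [ i ]} (here refl) (∈-upTo⁺ y<b) (∈-upTo⁺ z<c)

  slice-bound : xMarg X i ≤ b * c
  slice-bound = subst (xMarg X i ≤_) length-column (length-mono _ column unique-slice slice⊆column)

  slice-full : b * c ≤ xMarg X i → ∀ {y z} → y < b → z < c → (i , y , z) ∈ X
  slice-full bc≤ y<b z<c =
    proj₁ (∈-filter⁻ slice? {xs = X}
      (⊆-full _≟ₚ_ _ column unique-slice slice⊆column (subst (_≤ xMarg X i) (sym length-column) bc≤)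
        (∈-triples⁺ {xs = [ i ]} (here refl) (∈-upTo⁺ y<b) (∈-upTo⁺ z<c))))

unique-map-injOn : ∀ {A B : Set} (f : A → B) xs → (∀ {x y} → x ∈ xs → y ∈ xs → f x ≡ f y → x ≡ y) →
  Unique xs → Unique (map f xs)
unique-map-injOn f []       injOn []          = []
unique-map-injOn f (x ∷ xs) injOn (x∉ ∷ uxs) =
  AllP.map⁺ (tabulate (λ y∈ fx≡fy → All.lookup x∉ y∈ (injOn (here refl) (there y∈) fx≡fy)))
  ∷ unique-map-injOn f xs (λ x∈ y∈ → injOn (there x∈) (there y∈)) uxs

shift unshift : ℕ → Point → Point
shift   a v = (a + xOf v , proj₂ v)
unshift a v = (xOf v ∸ a , proj₂ v)

shift-inj : ∀ a {u v} → shift a u ≡ shift a v → u ≡ v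
shift-inj a {x , _} {x′ , _} eq = cong₂ _,_ (+-cancelˡ-≡ a x x′ (cong xOf eq)) (cong proj₂ eq)

shift-unshift : ∀ a {v} → a ≤ xOf v → shift a (unshift a v) ≡ v
shift-unshift a {x , _} a≤x = cong (_, _) (m+[n∸m]≡n a≤x)

module Lifting (a b c : ℕ) where

  box∌shift : ∀ {v} → shift a v ∈ box a b c → ⊥
  box∌shift {v} v∈ = <-irrefl refl (<-≤-trans (proj₁ (∈-box⁻ a b c v∈)) (m≤m+n a (xOf v)))

  lift-unique : ∀ P → Unique P → Unique (liftQ a b c P)
  lift-unique P uP = Unique.++⁺ (box-unique a b c) (Unique.map⁺ (shift-inj a) uP) disjoint
    where
    disjoint : ∀ {v} → ¬ (v ∈ box a b c × v ∈ map (shift a) P)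
    disjoint (v∈box , v∈shifted) with ∈-map⁻ (shift a) v∈shifted
    ... | _ , _ , refl = box∌shift v∈box

  lift-x-below : ∀ P {i} → i < a → xMarg (liftQ a b c P) i ≡ b * c
  lift-x-below P {i} i<a = begin
    xMarg (liftQ a b c P) i
      ≡⟨ count-++ xOf (box a b c) (map (shift a) P) i ⟩
    xMarg (box a b c) i + count xOf (map (shift a) P) i
      ≡⟨ cong₂ _+_ (box-xMarg a b c i) (count-map xOf (shift a) P i) ⟩
    colLen (replicate (b * c) a) i + count ((a +_) ∘ xOf) P i
      ≡⟨ cong₂ _+_ (colLen-rect-below (b * c) a i<a) (count-none ((a +_) ∘ xOf) P (λ _ → left-of-translate)) ⟩
    b * c + 0
      ≡⟨ +-identityʳ (b * c) ⟩
    b * c ∎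
    where
    open ≡-Reasoning
    left-of-translate : ∀ {x} → a + x ≢ i
    left-of-translate {x} eq = <⇒≱ i<a (subst (a ≤_) eq (m≤m+n a x))

  lift-x-above : ∀ P i → xMarg (liftQ a b c P) (a + i) ≡ xMarg P i
  lift-x-above P i = begin
    xMarg (liftQ a b c P) (a + i)
      ≡⟨ count-++ xOf (box a b c) (map (shift a) P) (a + i) ⟩
    xMarg (box a b c) (a + i) + count xOf (map (shift a) P) (a + i)
      ≡⟨ cong₂ _+_ (box-xMarg a b c (a + i)) (count-map xOf (shift a) P (a + i)) ⟩
    colLen (replicate (b * c) a) (a + i) + count ((a +_) ∘ xOf) P (a + i)
      ≡⟨ cong₂ _+_ (colLen-rect-above (b * c) a (m≤m+n a i)) (count-inj (a +_) (+-cancelˡ-≡ a _ _) xOf P i) ⟩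
    xMarg P i ∎
    where open ≡-Reasoning

  lift-y : ∀ P j → yMarg (liftQ a b c P) j ≡ colLen (replicate (a * c) b) j + yMarg P j
  lift-y P j = trans (count-++ yOf (box a b c) (map (shift a) P) j)
                     (cong₂ _+_ (box-yMarg a b c j) (count-map yOf (shift a) P j))

  lift-z : ∀ P k → zMarg (liftQ a b c P) k ≡ colLen (replicate (a * b) c) k + zMarg P k
  lift-z P k = trans (count-++ zOf (box a b c) (map (shift a) P) k)
                     (cong₂ _+_ (box-zMarg a b c k) (count-map zOf (shift a) P k))

  module _ (lam mu pi : List ℕ) (short : 0 < a → length lam ≤ b * c) where

    lift-marginals : ∀ P → HasMarginals P lam mu pi →
      HasMarginals (liftQ a b c P) (addFirst (b * c) a lam) (prepend (a * c) b mu) (prepend (a * b) c pi)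
    lift-marginals P (mx , my , mz) = marg-x , marg-y , marg-z
      where
      marg-x : ∀ i → xMarg (liftQ a b c P) i ≡ colLen (addFirst (b * c) a lam) i
      marg-x i with i <? a
      ... | yes i<a = trans (lift-x-below P i<a) (sym (colLen-addFirst-below (b * c) a lam (short (≤-<-trans z≤n i<a)) i<a))
      ... | no  i≮a = subst (λ t → xMarg (liftQ a b c P) t ≡ colLen (addFirst (b * c) a lam) t) (m+[n∸m]≡n (≮⇒≥ i≮a))
                        (trans (lift-x-above P (i ∸ a)) (trans (mx (i ∸ a)) (sym (colLen-addFirst-above (b * c) a lam (i ∸ a) short))))
      marg-y : ∀ j → yMarg (liftQ a b c P) j ≡ colLen (prepend (a * c) b mu) j
      marg-y j = trans (lift-y P j)
                   (trans (cong (colLen (replicate (a * c) b) j +_) (my j)) (sym (colLen-++ (replicate (a * c) b) mu j)))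
      marg-z : ∀ k → zMarg (liftQ a b c P) k ≡ colLen (prepend (a * b) c pi) k
      marg-z k = trans (lift-z P k)
                   (trans (cong (colLen (replicate (a * b) c) k +_) (mz k)) (sym (colLen-++ (replicate (a * b) c) pi k)))

    unlift-marginals : ∀ P →
      HasMarginals (liftQ a b c P) (addFirst (b * c) a lam) (prepend (a * c) b mu) (prepend (a * b) c pi) →
      HasMarginals P lam mu pi
    unlift-marginals P (mx , my , mz) = marg-x , marg-y , marg-z
      where
      marg-x : ∀ i → xMarg P i ≡ colLen lam i
      marg-x i = trans (sym (lift-x-above P i)) (trans (mx (a + i)) (colLen-addFirst-above (b * c) a lam i short))
      marg-y : ∀ j → yMarg P j ≡ colLen mu j
      marg-y j = +-cancelˡ-≡ (colLen (replicate (a * c) b) j) _ _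
                   (trans (sym (lift-y P j)) (trans (my j) (colLen-++ (replicate (a * c) b) mu j)))
      marg-z : ∀ k → zMarg P k ≡ colLen pi k
      marg-z k = +-cancelˡ-≡ (colLen (replicate (a * b) c) k) _ _
                   (trans (sym (lift-z P k)) (trans (mz k) (colLen-++ (replicate (a * b) c) pi k)))

  lift-⊆ : ∀ P P′ → liftQ a b c P ⊆ liftQ a b c P′ → P ⊆ P′
  lift-⊆ P P′ sub {v} v∈ with ∈-++⁻ (box a b c) (sub (∈-++⁺ʳ (box a b c) (∈-map⁺ (shift a) v∈)))
  ... | inj₁ v∈box     = ⊥-elim (box∌shift v∈box)
  ... | inj₂ v∈shifted with ∈-map⁻ (shift a) v∈shifted
  ...   | w , w∈ , eq = subst (_∈ P′) (sym (shift-inj a eq)) w∈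

  lift-injective : ∀ P P′ → liftQ a b c P ≈ₛ liftQ a b c P′ → P ≈ₛ P′
  lift-injective P P′ eq _ = mk⇔ (lift-⊆ P P′ (Equivalence.to (eq _))) (lift-⊆ P′ P (Equivalence.from (eq _)))

  right? : Decidable (λ v → a ≤ xOf v)
  right? v = a ≤? xOf v

  unlift : List Point → List Point
  unlift Q = map (unshift a) (filter right? Q)

  unlift-unique : ∀ Q → Unique Q → Unique (unlift Q)
  unlift-unique Q uQ = unique-map-injOn (unshift a) (filter right? Q) injOn (Unique.filter⁺ right? uQ)
    where
    injOn : ∀ {u v} → u ∈ filter right? Q → v ∈ filter right? Q → unshift a u ≡ unshift a v → u ≡ v
    injOn u∈ v∈ eq = begin
      _                       ≡⟨ shift-unshift a (proj₂ (∈-filter⁻ right? {xs = Q} u∈)) ⟨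
      shift a (unshift a _)   ≡⟨ cong (shift a) eq ⟩
      shift a (unshift a _)   ≡⟨ shift-unshift a (proj₂ (∈-filter⁻ right? {xs = Q} v∈)) ⟩
      _                       ∎
      where open ≡-Reasoning

  lift-unlift : ∀ Q → box a b c ⊆ Q → OverRect b c Q → liftQ a b c (unlift Q) ≈ₛ Q
  lift-unlift Q box⊆Q over _ = mk⇔ into onto
    where
    into : liftQ a b c (unlift Q) ⊆ Q
    into v∈ with ∈-++⁻ (box a b c) v∈
    ... | inj₁ v∈box     = box⊆Q v∈box
    ... | inj₂ v∈shifted with ∈-map⁻ (shift a) v∈shifted
    ...   | _ , w∈ , refl with ∈-map⁻ (unshift a) w∈
    ...     | u , u∈ , refl with ∈-filter⁻ right? {xs = Q} u∈
    ...       | u∈Q , a≤x = subst (_∈ Q) (sym (shift-unshift a a≤x)) u∈Q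
    onto : Q ⊆ liftQ a b c (unlift Q)
    onto {x , y , z} v∈ with x <? a
    ... | yes x<a = ∈-++⁺ˡ (∈-box⁺ a b c x<a (proj₁ (over v∈)) (proj₂ (over v∈)))
    ... | no  x≮a = ∈-++⁺ʳ (box a b c)
                      (subst (_∈ map (shift a) (unlift Q)) (shift-unshift a (≮⇒≥ x≮a))
                        (∈-map⁺ (shift a) (∈-map⁺ (unshift a) (∈-filter⁺ right? v∈ (≮⇒≥ x≮a)))))

  lift-pyramid : ∀ P → Pyramid P → OverRect b c P → Pyramid (liftQ a b c P)
  lift-pyramid P pyr over x y z x′ y′ z′ v∈ x′≤x y′≤y z′≤z with ∈-++⁻ (box a b c) v∈
  ... | inj₁ v∈box = let x<a , y<b , z<c = ∈-box⁻ a b c v∈box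
                     in ∈-++⁺ˡ (∈-box⁺ a b c (≤-<-trans x′≤x x<a) (≤-<-trans y′≤y y<b) (≤-<-trans z′≤z z<c))
  ... | inj₂ v∈shifted with ∈-map⁻ (shift a) v∈shifted
  ...   | (w , _ , _) , w∈ , refl with x′ <? a
  ...     | yes x′<a = let y<b , z<c = over w∈
                       in ∈-++⁺ˡ (∈-box⁺ a b c x′<a (≤-<-trans y′≤y y<b) (≤-<-trans z′≤z z<c))
  ...     | no  x′≮a = ∈-++⁺ʳ (box a b c)
                         (subst (_∈ map (shift a) P) (shift-unshift a (≮⇒≥ x′≮a))
                           (∈-map⁺ (shift a) (pyr w y z (x′ ∸ a) y′ z′ w∈
                             (subst (x′ ∸ a ≤_) (m+n∸m≡n a w) (∸-monoˡ-≤ a x′≤x)) y′≤y z′≤z)))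

∈-simplex⁺ : ∀ s {v} → level v < s → v ∈ simplex s
∈-simplex⁺ s {x , y , z} lv<s =
  ∈-triples⁺ {xs = upTo s} {ys = λ _ → upTo s} {zs = λ x y → filter (λ z → suc (x + y + z) ≤? s) (upTo s)}
    (∈-upTo⁺ (≤-<-trans (≤-trans (m≤m+n x y) (m≤m+n (x + y) z)) lv<s))
    (∈-upTo⁺ (≤-<-trans (≤-trans (m≤n+m y x) (m≤m+n (x + y) z)) lv<s))
    (∈-filter⁺ (λ z → suc (x + y + z) ≤? s) (∈-upTo⁺ (≤-<-trans (m≤n+m z (x + y)) lv<s)) lv<s)

∈-simplex⁻ : ∀ s {v} → v ∈ simplex s → level v < s
∈-simplex⁻ s {x , y , z} v∈ =
  let _ , _ , z∈ = ∈-triples⁻ {xs = upTo s} {ys = λ _ → upTo s} {zs = λ x y → filter (λ z → suc (x + y + z) ≤? s) (upTo s)} v∈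
  in proj₂ (∈-filter⁻ (λ z → suc (x + y + z) ≤? s) {xs = upTo s} z∈)

rOf-fits : ∀ n → length (simplex (rOf n)) ≤ n
rOf-fits n = search-fits n
  where
  search-fits : ∀ k → length (simplex (maxRUpTo n k)) ≤ n
  search-fits zero    = z≤n
  search-fits (suc k) = decide (length (simplex (suc k)) ≤? n)
    where
    decide : (d : Dec (length (simplex (suc k)) ≤ n)) → length (simplex (if does d then suc k else maxRUpTo n k)) ≤ n
    decide (yes fits) = fits
    decide (no  _)    = search-fits k

-- The bookkeeping behind the lower bound: with |A| = a ≤ m = |P_s| ≤ n = a + β,
-- the deficit K(m − a) of A against P_s is paid for by the β points of level ≥ K + 1.
exchange-arith : ∀ ΣS ΣA ΣB K a m n β → ΣS ≤ ΣA + K * (m ∸ a) → a ≤ m → m ≤ n → n ≡ a + β →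
  suc K * β ≤ ΣB → ΣS + suc K * (n ∸ m) ≤ ΣA + ΣB
exchange-arith ΣS ΣA ΣB K a m n β ΣS≤ a≤m m≤n n≡a+β sKβ≤ with m≤n⇒∃[o]m+o≡n a≤m | m≤n⇒∃[o]m+o≡n m≤n
... | d , refl | e , refl = begin
  ΣS + suc K * (a + d + e ∸ (a + d))  ≡⟨ cong (λ t → ΣS + suc K * t) (m+n∸m≡n (a + d) e) ⟩
  ΣS + suc K * e                      ≤⟨ +-monoˡ-≤ (suc K * e) (subst (λ t → ΣS ≤ ΣA + K * t) (m+n∸m≡n a d) ΣS≤) ⟩
  ΣA + K * d + suc K * e              ≤⟨ +-monoˡ-≤ (suc K * e) (+-monoʳ-≤ ΣA (*-monoˡ-≤ d (n≤1+n K))) ⟩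
  ΣA + suc K * d + suc K * e          ≡⟨ +-assoc ΣA (suc K * d) (suc K * e) ⟩
  ΣA + (suc K * d + suc K * e)        ≡⟨ cong (ΣA +_) (*-distribˡ-+ (suc K) d e) ⟨
  ΣA + suc K * (d + e)                ≡⟨ cong (λ t → ΣA + suc K * t) β≡d+e ⟨
  ΣA + suc K * β                      ≤⟨ +-monoʳ-≤ ΣA sKβ≤ ⟩
  ΣA + ΣB                             ∎
  where
  open ≤-Reasoning
  β≡d+e : β ≡ d + e
  β≡d+e = +-cancelˡ-≡ a β (d + e) (trans (sym n≡a+β) (+-assoc a d e))

-- Lower bound: an n-point set has total level at least b_s·(1,1,1) + s(n − |P_s|)
-- whenever |P_s| ≤ n.  Its points of level < s form a subset of P_s, and each
-- other point has level ≥ s.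
level-lower-bound : ∀ s n P → Unique P → length P ≡ n → length (simplex s) ≤ n →
  bDot s + s * (n ∸ length (simplex s)) ≤ sumL level P
level-lower-bound zero    n P uP |P|≡n fits = z≤n
level-lower-bound (suc K) n P uP |P|≡n fits =
  subst (bDot (suc K) + suc K * (n ∸ length S) ≤_) (sym (sumL-split level low? P))
    (exchange-arith (sumL level S) (sumL level A) (sumL level B) K (length A) (length S) n (length B)
      (sumL-exchange level K A S (Unique.filter⁺ low? uP) A⊆S (λ v∈ → ≤-pred (∈-simplex⁻ (suc K) v∈)))
      (length-mono A S (Unique.filter⁺ low? uP) A⊆S) fits |P|≡|A|+|B|
      (sumL-lower level (suc K) B (λ {v} v∈ → ≮⇒≥ (proj₂ (∈-filter⁻ (∁? low?) {xs = P} v∈)))))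
  where
  low? : Decidable (λ v → level v < suc K)
  low? v = level v <? suc K
  S A B : List Point
  S = simplex (suc K)
  A = filter low? P
  B = filter (∁? low?) P
  A⊆S : A ⊆ S
  A⊆S v∈ = ∈-simplex⁺ (suc K) (proj₂ (∈-filter⁻ low? {xs = P} v∈))
  |P|≡|A|+|B| : n ≡ length A + length B
  |P|≡|A|+|B| = begin
    n                                          ≡⟨ |P|≡n ⟨
    length P                                   ≡⟨ sumL-const1 P ⟨
    sumL (λ _ → 1) P                           ≡⟨ sumL-split (λ _ → 1) low? P ⟩
    sumL (λ _ → 1) A + sumL (λ _ → 1) B        ≡⟨ cong₂ _+_ (sumL-const1 A) (sumL-const1 B) ⟩
    length A + length B                        ∎
    where open ≡-Reasoning

pFun≤level : ∀ n P → Unique P → length P ≡ n → pFun n ≤ sumL level P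
pFun≤level n P uP |P|≡n = level-lower-bound (rOf n) n P uP |P|≡n (rOf-fits n)

descend : ∀ {Q : ℕ → Set} → (∀ k → Q (suc k) → Q k) → ∀ {m k} → m ≤ k → Q k → Q m
descend {Q} step m≤k = go (≤⇒≤′ m≤k)
  where
  go : ∀ {m k} → m ≤′ k → Q k → Q m
  go ≤′-refl        q = q
  go (≤′-step m≤′k) q = go m≤′k (step _ q)

-- An n-point set of total level exactly p(n) is a pyramid: otherwise some point v of
-- it has a lower neighbour w outside it, and replacing v by w lowers the total level
-- below the minimum p(n).
minimal⇒pyramid : ∀ n P → Unique P → length P ≡ n → sumL level P ≡ pFun n → Pyramid P
minimal⇒pyramid n P uP |P|≡n minimal x y z x′ y′ z′ v∈ x′≤x y′≤y z′≤z =
  descend {λ t → (x′ , y′ , t) ∈ P} (λ k → step-down (+-suc (x′ + y′) k)) z′≤z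
    (descend {λ t → (x′ , t , z) ∈ P} (λ k → step-down (cong (_+ z) (+-suc x′ k))) y′≤y
      (descend {λ t → (t , y , z) ∈ P} (λ k → step-down refl) x′≤x v∈))
  where
  step-down : ∀ {v w} → level v ≡ suc (level w) → v ∈ P → w ∈ P
  step-down {v} {w} lv≡ v∈P with any? (w ≟ₚ_) P
  ... | yes w∈P = w∈P
  ... | no  w∉P with ∈-∃++ v∈P
  ...   | ps , qs , refl = ⊥-elim (<-irrefl refl (begin-strict
    pFun n                        ≤⟨ pFun≤level n (w ∷ ps ++ qs) u′ (trans (sym (length-++-sucʳ ps v qs)) |P|≡n) ⟩
    level w + sumL level (ps ++ qs) <⟨ +-monoˡ-< (sumL level (ps ++ qs)) (≤-reflexive (sym lv≡)) ⟩
    level v + sumL level (ps ++ qs) ≡⟨ sumL-middle level ps qs ⟨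
    sumL level (ps ++ v ∷ qs)       ≡⟨ minimal ⟩
    pFun n                          ∎))
    where
    open ≤-Reasoning
    u′ : Unique (w ∷ ps ++ qs)
    u′ = tabulate (λ u∈ w≡u → w∉P (subst (_∈ ps ++ v ∷ qs) (sym w≡u) (∈-insert′ ps qs u∈))) ∷ unique-delete ps qs uP

simplexLike⇒pyramid : ∀ n P lam mu pi → Unique P → HasMarginals P lam mu pi → SimplexLike n lam mu pi → Pyramid P
simplexLike⇒pyramid n P lam mu pi uP marg (|λ|≡n , _ , _ , _ , weights) =
  minimal⇒pyramid n P uP (trans (length-marg xOf P lam (proj₁ marg)) |λ|≡n) (trans (level-marg P lam mu pi marg) weights)

marginals-≈ : ∀ X Y {α β γ} → Unique X → Unique Y → X ≈ₛ Y → HasMarginals Y α β γ → HasMarginals X α β γ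
marginals-≈ X Y uX uY X≈Y (mx , my , mz) =
  (λ i → trans (same xOf i) (mx i)) , (λ j → trans (same yOf j) (my j)) , (λ k → trans (same zOf k) (mz k))
  where
  same : ∀ h i → count h X i ≡ count h Y i
  same h i = count-≈ h X Y i uX uY (Equivalence.to (X≈Y _)) (Equivalence.from (X≈Y _))

pyramid-≈ : ∀ X Y → X ≈ₛ Y → Pyramid X → Pyramid Y
pyramid-≈ X Y X≈Y pyr x y z x′ y′ z′ v∈ x′≤x y′≤y z′≤z =
  Equivalence.to (X≈Y _) (pyr x y z x′ y′ z′ (Equivalence.from (X≈Y _) v∈) x′≤x y′≤y z′≤z)

module Correspondence (a b c : ℕ) (lam mu pi : List ℕ)
  (lam>0 : All (0 <_) lam) (mu≤b : All (_≤ b) mu) (pi≤c : All (_≤ c) pi) where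

  open Lifting a b c

  HasTarget : List Point → Set
  HasTarget Q = HasMarginals Q (addFirst (b * c) a lam) (prepend (a * c) b mu) (prepend (a * b) c pi)

  -- The added parts b and c keep the bounds b and c, so targets lie over the rectangle too.
  target-overRect : ∀ Q → HasTarget Q → OverRect b c Q
  target-overRect Q = marg-overRect Q (addFirst (b * c) a lam) (prepend (a * c) b mu) (prepend (a * b) c pi)
    (AllP.++⁺ (AllP.replicate⁺ (a * c) ≤-refl) mu≤b) (AllP.++⁺ (AllP.replicate⁺ (a * b) ≤-refl) pi≤c)

  -- λ has at most bc parts, as its parts count the slice x = 0 of any P ...
  short-from-source : ∀ P → Unique P → HasMarginals P lam mu pi → length lam ≤ b * c
  short-from-source P uP marg = begin
    length lam    ≡⟨ colLen-all lam lam>0 ⟨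
    colLen lam 0  ≡⟨ proj₁ marg 0 ⟨
    xMarg P 0     ≤⟨ slice-bound P uP (marg-overRect P lam mu pi mu≤b pi≤c marg) 0 ⟩
    b * c         ∎
    where open ≤-Reasoning

  -- ... and, when a > 0, of any Q with the target marginals.
  short-from-target : ∀ Q → Unique Q → HasTarget Q → 0 < a → length lam ≤ b * c
  short-from-target Q uQ marg 0<a = begin
    length lam                              ≤⟨ length≤colLen-addFirst (b * c) a lam 0<a lam>0 ⟩
    colLen (addFirst (b * c) a lam) 0       ≡⟨ proj₁ marg 0 ⟨
    xMarg Q 0                               ≤⟨ slice-bound Q uQ (target-overRect Q marg) 0 ⟩
    b * c                                   ∎
    where open ≤-Reasoning

  forward : ∀ P → Unique P → HasMarginals P lam mu pi → Unique (liftQ a b c P) × HasTarget (liftQ a b c P)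
  forward P uP marg = lift-unique P uP , lift-marginals lam mu pi (λ _ → short-from-source P uP marg) P marg

  -- Every target is the lift of a source: it contains the box, since each slice x = i < a
  -- has bc points over the b × c rectangle, and the rest is a translated source.
  surjective : ∀ Q → Unique Q → HasTarget Q →
    Σ (List Point) (λ P → Unique P × HasMarginals P lam mu pi × (liftQ a b c P ≈ₛ Q))
  surjective Q uQ marg = unlift Q , unlift-unique Q uQ , unlift-marginals lam mu pi short (unlift Q) marg-lift , lift≈Q
    where
    short : 0 < a → length lam ≤ b * c
    short = short-from-target Q uQ marg
    box⊆Q : box a b c ⊆ Q
    box⊆Q {x , y , z} v∈ =
      let x<a , y<b , z<c = ∈-box⁻ a b c v∈
          full = trans (proj₁ marg x) (colLen-addFirst-below (b * c) a lam (short (≤-<-trans z≤n x<a)) x<a)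
      in slice-full Q uQ (target-overRect Q marg) x (≤-reflexive (sym full)) y<b z<c
    lift≈Q : liftQ a b c (unlift Q) ≈ₛ Q
    lift≈Q = lift-unlift Q box⊆Q (target-overRect Q marg)
    marg-lift : HasTarget (liftQ a b c (unlift Q))
    marg-lift = marginals-≈ _ Q {addFirst (b * c) a lam} {prepend (a * c) b mu} {prepend (a * b) c pi}
                  (lift-unique (unlift Q) (unlift-unique Q uQ)) uQ lift≈Q marg

  -- Targets are pyramids when λ, μ, π are simplex-like: they are lifts of pyramids.
  target-pyramid : ∀ n → SimplexLike n lam mu pi → ∀ Q → Unique Q → HasTarget Q → Pyramid Q
  target-pyramid n simplexLike Q uQ marg =
    let P , uP , margP , lift≈Q = surjective Q uQ marg
    in pyramid-≈ _ Q lift≈Q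
         (lift-pyramid P (simplexLike⇒pyramid n P lam mu pi uP margP simplexLike) (marg-overRect P lam mu pi mu≤b pi≤c margP))

lemma4p4 : (n r a b c : ℕ) (lam mu pi : List ℕ) →
    IsPartition lam → IsPartition mu → IsPartition pi →
    SimplexLike n lam mu pi →
    r * (r + 1) * (r + 2) ≤ 6 * n → 6 * n < (r + 1) * (r + 2) * (r + 3) →
    All (λ p → p ≤ suc r) lam → All (λ p → p ≤ suc r) mu → All (λ p → p ≤ suc r) pi →
    suc r ≤ b → suc r ≤ c →
    ((P : List Point) → Unique P → HasMarginals P lam mu pi →
        Unique (liftQ a b c P) ×
        HasMarginals (liftQ a b c P) (addFirst (b * c) a lam) (prepend (a * c) b mu) (prepend (a * b) c pi))
    × ((P P′ : List Point) → Unique P → HasMarginals P lam mu pi →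
        Unique P′ → HasMarginals P′ lam mu pi →
        liftQ a b c P ≈ₛ liftQ a b c P′ → P ≈ₛ P′)
    × ((Q : List Point) → Unique Q →
        HasMarginals Q (addFirst (b * c) a lam) (prepend (a * c) b mu) (prepend (a * b) c pi) →
        Σ (List Point) (λ P → Unique P × HasMarginals P lam mu pi × (liftQ a b c P ≈ₛ Q)))
    × ((Q : List Point) → Unique Q →
        HasMarginals Q (addFirst (b * c) a lam) (prepend (a * c) b mu) (prepend (a * b) c pi) →
        Pyramid Q)
lemma4p4 n r a b c lam mu pi (_ , lam>0) _ _ simplexLike _ _ _ mu≤r+1 pi≤r+1 r<b r<c =
  forward , (λ P P′ _ _ _ _ → lift-injective P P′) , surjective , target-pyramid n simplexLike
  where
  open Lifting a b c using (lift-injective)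
  open Correspondence a b c lam mu pi lam>0
    (All.map (λ p≤ → ≤-trans p≤ r<b) mu≤r+1) (All.map (λ p≤ → ≤-trans p≤ r<c) pi≤r+1)
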